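{- Let $n\geq 0$ be an integer and put $\Delta(n,1)=r_{01}(n)-r_{01}(n+1)$. Then $\Delta(n,1)\in\{ -1,0,1\}$. More precisely, let $u=v_2(n+1)$ and let $\varepsilon\in\{0,1\}$ be such that $n+1\equiv 2^{u}+\varepsilon 2^{u+1}\pmod{2^{u+2}}$. Then: (i) if $u=0$ and $\varepsilon=0$, $\Delta(n,1)=-1$; (ii) if $u=0$ and $\varepsilon=1$, $\Delta(n,1)=0$; (iii) if $u>0$ and $\varepsilon=0$, $\Delta(n,1)=0$; (iv) if $u>0$ and $\varepsilon=1$, $\Delta(n,1)=1$.
   Context: For $n\in\mathbb{N}$, $r_{01}(n)$ is the number of occurrences of the block $01$ in the binary expansion of $n$, where the most significant digit $1$ is also counted as forming a block $01$ (the expansion is regarded as preceded by a $0$). $v_2(m)$ denotes the $2$-adic valuation of a positive integer $m$. -}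

module Defs where

open import Data.Bool using (Bool; true; false)
open import Data.List using (List; []; _∷_)
open import Data.Nat using (ℕ; zero; suc; _%_; _/_; _≡ᵇ_)

-- binary digits of n, least significant first, without leading zeros.
-- The first argument is fuel; fuel n suffices since each step halves n.
bitsAux : ℕ → ℕ → List Bool
bitsAux zero    _       = []
bitsAux (suc k) zero    = []
bitsAux (suc k) (suc m) = ((suc m % 2) ≡ᵇ 1) ∷ bitsAux k (suc m / 2)

bits : ℕ → List Bool
bits n = bitsAux n n

-- number of blocks "01" in a digit list given least significant first,
-- i.e. positions with digit 1 whose next more significant digit is 0;
-- the expansion is regarded as preceded by a 0, so the top digit 1 counts.
count01 : List Bool → ℕ
count01 []                  = 0
count01 (true ∷ [])         = 1
count01 (true ∷ false ∷ bs) = suc (count01 (false ∷ bs))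
count01 (true ∷ true ∷ bs)  = count01 (true ∷ bs)
count01 (false ∷ bs)        = count01 bs

r01 : ℕ → ℕ
r01 n = count01 (bits n)

-- Write n + 1 = 2^u · m with m = 1 + 2j odd and j = ε + 2k. In binary, n + 1 is (1 + 2j)
-- followed by u zeros and n is 2j followed by u ones. Trailing zeros never affect r01,
-- and appending u ≥ 1 ones to the even number 2j creates exactly one new block 01, so
-- r01 n = [u > 0] + r01 j. On the other side, 1 + 2j ends in 01 when j is even
-- (ε = 0) and in 11 when j is odd (ε = 1), so r01 (1 + 2j) = r01 j + 1 − ε. Hence
-- Δ(n,1) = [u > 0] + ε − 1.
module Submission where

open import Defs
open import Data.Bool using (true; false)
open import Data.List using (_∷_)
open import Data.Nat using (ℕ; zero; suc; _^_; _*_; _+_; _%_; _/_; _≡ᵇ_; _⊓_; _≤_; _<_; z≤n; s≤s; NonZero)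
open import Data.Nat.Properties
open import Data.Nat.DivMod
open import Data.Nat.Divisibility using (_∣_; divides; m∣m*n)
open import Data.Integer using (ℤ; +_; _-_; -[1+_]; _⊖_)
open import Data.Integer.Properties using ([+m]-[+n]≡m⊖n; +-cancelˡ-⊖)
open import Data.Nat.Tactic.RingSolver using (solve-∀)
open import Algebra.Properties.CommutativeSemigroup +-commutativeSemigroup using (x∙yz≈y∙xz)
open import Data.Product using (_×_; _,_; ∃)
open import Data.Sum using (_⊎_; inj₁; inj₂)
open import Relation.Nullary using (¬_)
open import Relation.Binary.PropositionalEquality
open ≡-Reasoning

[1+m]/2≤m : ∀ m → suc m / 2 ≤ m
[1+m]/2≤m m = <⇒≤pred (m/n<m (suc m) 2 (s≤s (s≤s z≤n)))

bitsAux-fuel-irrelevant : ∀ k k′ m → m ≤ k → m ≤ k′ → bitsAux k m ≡ bitsAux k′ m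
bitsAux-fuel-irrelevant zero    zero     zero    _       _        = refl
bitsAux-fuel-irrelevant zero    (suc k′) zero    _       _        = refl
bitsAux-fuel-irrelevant (suc k) zero     zero    _       _        = refl
bitsAux-fuel-irrelevant (suc k) (suc k′) zero    _       _        = refl
bitsAux-fuel-irrelevant (suc k) (suc k′) (suc m) (s≤s m≤k) (s≤s m≤k′) =
  cong (_ ∷_) (bitsAux-fuel-irrelevant k k′ (suc m / 2) (≤-trans ([1+m]/2≤m m) m≤k) (≤-trans ([1+m]/2≤m m) m≤k′))

bits-suc : ∀ m → bits (suc m) ≡ (suc m % 2 ≡ᵇ 1) ∷ bits (suc m / 2)
bits-suc m = cong ((suc m % 2 ≡ᵇ 1) ∷_) (bitsAux-fuel-irrelevant m (suc m / 2) (suc m / 2) ([1+m]/2≤m m) ≤-refl)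

[m+2*n]%2≡m : ∀ m n → m < 2 → (m + 2 * n) % 2 ≡ m
[m+2*n]%2≡m m n m<2 = begin
  (m + 2 * n) % 2 ≡⟨ cong (λ x → (m + x) % 2) (*-comm 2 n) ⟩
  (m + n * 2) % 2 ≡⟨ [m+kn]%n≡m%n m n 2 ⟩
  m % 2           ≡⟨ m<n⇒m%n≡m m<2 ⟩
  m               ∎

[m+2*n]/2≡n : ∀ m n → m < 2 → (m + 2 * n) / 2 ≡ n
[m+2*n]/2≡n m n m<2 = begin
  (m + 2 * n) / 2   ≡⟨ +-distrib-/-∣ʳ m (m∣m*n n) ⟩
  m / 2 + 2 * n / 2 ≡⟨ cong₂ _+_ (m<n⇒m/n≡0 m<2) (trans (cong (_/ 2) (*-comm 2 n)) (m*n/n≡m n 2)) ⟩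
  n                 ∎

bits-1+2*m : ∀ m → bits (1 + 2 * m) ≡ true ∷ bits m
bits-1+2*m m = begin
  bits (1 + 2 * m)                             ≡⟨ bits-suc (2 * m) ⟩
  ((1 + 2 * m) % 2 ≡ᵇ 1) ∷ bits ((1 + 2 * m) / 2)
    ≡⟨ cong₂ (λ b q → (b ≡ᵇ 1) ∷ bits q) ([m+2*n]%2≡m 1 m ≤-refl) ([m+2*n]/2≡n 1 m ≤-refl) ⟩
  true ∷ bits m                                ∎

bits-2*[1+m] : ∀ m → bits (2 * suc m) ≡ false ∷ bits (suc m)
bits-2*[1+m] m = begin
  bits (2 * suc m)                             ≡⟨ bits-suc _ ⟩
  ((2 * suc m) % 2 ≡ᵇ 1) ∷ bits ((2 * suc m) / 2)
    ≡⟨ cong₂ (λ b q → (b ≡ᵇ 1) ∷ bits q) ([m+2*n]%2≡m 0 (suc m) (s≤s z≤n)) ([m+2*n]/2≡n 0 (suc m) (s≤s z≤n)) ⟩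
  false ∷ bits (suc m)                         ∎

r01[2*m]≡r01[m] : ∀ m → r01 (2 * m) ≡ r01 m
r01[2*m]≡r01[m] zero    = refl
r01[2*m]≡r01[m] (suc m) = cong count01 (bits-2*[1+m] m)

r01[2^k*m]≡r01[m] : ∀ k m → r01 (2 ^ k * m) ≡ r01 m
r01[2^k*m]≡r01[m] zero    m = cong r01 (+-identityʳ m)
r01[2^k*m]≡r01[m] (suc k) m = begin
  r01 (2 * 2 ^ k * m)   ≡⟨ cong r01 (*-assoc 2 (2 ^ k) m) ⟩
  r01 (2 * (2 ^ k * m)) ≡⟨ r01[2*m]≡r01[m] (2 ^ k * m) ⟩
  r01 (2 ^ k * m)       ≡⟨ r01[2^k*m]≡r01[m] k m ⟩
  r01 m                 ∎

r01[1+2*[2*k]]≡1+r01[k] : ∀ k → r01 (1 + 2 * (2 * k)) ≡ 1 + r01 k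
r01[1+2*[2*k]]≡1+r01[k] zero    = refl
r01[1+2*[2*k]]≡1+r01[k] (suc k) = begin
  count01 (bits (1 + 2 * (2 * suc k))) ≡⟨ cong count01 (bits-1+2*m (2 * suc k)) ⟩
  count01 (true ∷ bits (2 * suc k))    ≡⟨ cong (λ bs → count01 (true ∷ bs)) (bits-2*[1+m] k) ⟩
  1 + r01 (suc k)                      ∎

r01[1+2*[1+2*k]]≡r01[1+2*k] : ∀ k → r01 (1 + 2 * (1 + 2 * k)) ≡ r01 (1 + 2 * k)
r01[1+2*[1+2*k]]≡r01[1+2*k] k = begin
  count01 (bits (1 + 2 * (1 + 2 * k))) ≡⟨ cong count01 (bits-1+2*m (1 + 2 * k)) ⟩
  count01 (true ∷ bits (1 + 2 * k))    ≡⟨ cong (λ bs → count01 (true ∷ bs)) (bits-1+2*m k) ⟩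
  count01 (true ∷ true ∷ bits k)       ≡⟨ cong count01 (bits-1+2*m k) ⟨
  r01 (1 + 2 * k)                      ∎

withOnes : ℕ → ℕ → ℕ
withOnes zero    x = x
withOnes (suc u) x = 1 + 2 * withOnes u x

1+withOnes≡2^u*[1+x] : ∀ u x → 1 + withOnes u x ≡ 2 ^ u * (1 + x)
1+withOnes≡2^u*[1+x] zero    x = sym (+-identityʳ (suc x))
1+withOnes≡2^u*[1+x] (suc u) x = begin
  2 + 2 * withOnes u x    ≡⟨ *-suc 2 (withOnes u x) ⟨
  2 * (1 + withOnes u x)  ≡⟨ cong (2 *_) (1+withOnes≡2^u*[1+x] u x) ⟩
  2 * (2 ^ u * (1 + x))   ≡⟨ *-assoc 2 (2 ^ u) (1 + x) ⟨
  2 ^ suc u * (1 + x)     ∎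

r01[withOnes-u-2*j]≡[1⊓u]+r01[j] : ∀ u j → r01 (withOnes u (2 * j)) ≡ 1 ⊓ u + r01 j
r01[withOnes-u-2*j]≡[1⊓u]+r01[j] zero          j = r01[2*m]≡r01[m] j
r01[withOnes-u-2*j]≡[1⊓u]+r01[j] (suc zero)    j = r01[1+2*[2*k]]≡1+r01[k] j
r01[withOnes-u-2*j]≡[1⊓u]+r01[j] (suc (suc u)) j =
  trans (r01[1+2*[1+2*k]]≡r01[1+2*k] (withOnes u (2 * j))) (r01[withOnes-u-2*j]≡[1⊓u]+r01[j] (suc u) j)

r01[1+2*[ε+2*k]]+ε≡r01[ε+2*k]+1 : ∀ ε k → ε ≤ 1 → r01 (1 + 2 * (ε + 2 * k)) + ε ≡ r01 (ε + 2 * k) + 1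
r01[1+2*[ε+2*k]]+ε≡r01[ε+2*k]+1 zero k _ = begin
  r01 (1 + 2 * (2 * k)) + 0 ≡⟨ +-identityʳ _ ⟩
  r01 (1 + 2 * (2 * k))     ≡⟨ r01[1+2*[2*k]]≡1+r01[k] k ⟩
  1 + r01 k                 ≡⟨ +-comm 1 (r01 k) ⟩
  r01 k + 1                 ≡⟨ cong (_+ 1) (r01[2*m]≡r01[m] k) ⟨
  r01 (2 * k) + 1           ∎
r01[1+2*[ε+2*k]]+ε≡r01[ε+2*k]+1 (suc zero) k _ = cong (_+ 1) (r01[1+2*[1+2*k]]≡r01[1+2*k] k)
r01[1+2*[ε+2*k]]+ε≡r01[ε+2*k]+1 (suc (suc _)) _ (s≤s ())

r01[n]+1≡r01[1+n]+[1⊓u+ε] : ∀ {n} u ε k → ε ≤ 1 → suc n ≡ 2 ^ u * (1 + 2 * (ε + 2 * k)) →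
  r01 n + 1 ≡ r01 (suc n) + (1 ⊓ u + ε)
r01[n]+1≡r01[1+n]+[1⊓u+ε] {n} u ε k ε≤1 n+1≡ = begin
  r01 n + 1                               ≡⟨ cong (λ m → r01 m + 1) n≡withOnes ⟩
  r01 (withOnes u (2 * j)) + 1            ≡⟨ cong (_+ 1) (r01[withOnes-u-2*j]≡[1⊓u]+r01[j] u j) ⟩
  1 ⊓ u + r01 j + 1                       ≡⟨ +-assoc (1 ⊓ u) (r01 j) 1 ⟩
  1 ⊓ u + (r01 j + 1)                     ≡⟨ cong (λ x → 1 ⊓ u + x) (r01[1+2*[ε+2*k]]+ε≡r01[ε+2*k]+1 ε k ε≤1) ⟨
  1 ⊓ u + (r01 (1 + 2 * j) + ε)           ≡⟨ x∙yz≈y∙xz (1 ⊓ u) (r01 (1 + 2 * j)) ε ⟩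
  r01 (1 + 2 * j) + (1 ⊓ u + ε)           ≡⟨ cong (_+ (1 ⊓ u + ε)) (r01[2^k*m]≡r01[m] u (1 + 2 * j)) ⟨
  r01 (2 ^ u * (1 + 2 * j)) + (1 ⊓ u + ε) ≡⟨ cong (λ m → r01 m + (1 ⊓ u + ε)) n+1≡ ⟨
  r01 (suc n) + (1 ⊓ u + ε)               ∎
  where
  j : ℕ
  j = ε + 2 * k
  n≡withOnes : n ≡ withOnes u (2 * j)
  n≡withOnes = suc-injective (trans n+1≡ (sym (1+withOnes≡2^u*[1+x] u (2 * j))))

[m*o]%[n*o]≡[k*o]%[n*o]⇒m%n≡k%n : ∀ m k n o .{{_ : NonZero n}} .{{_ : NonZero o}} .{{_ : NonZero (n * o)}} →
  (m * o) % (n * o) ≡ (k * o) % (n * o) → m % n ≡ k % n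
[m*o]%[n*o]≡[k*o]%[n*o]⇒m%n≡k%n m k n o eq = *-cancelʳ-≡ (m % n) (k % n) o (begin
  m % n * o         ≡⟨ m%n*o≡m*o%[n*o] m n o ⟩
  (m * o) % (n * o) ≡⟨ eq ⟩
  (k * o) % (n * o) ≡⟨ m%n*o≡m*o%[n*o] k n o ⟨
  k % n * o         ∎)

2^u∣m⇒m≡2^u*[1+2*[ε+2*k]] : ∀ m u ε → ε ≤ 1 → 2 ^ u ∣ m →
  _%_ m (2 ^ (2 + u)) ⦃ m^n≢0 2 (2 + u) ⦄ ≡ _%_ (2 ^ u + ε * 2 ^ (1 + u)) (2 ^ (2 + u)) ⦃ m^n≢0 2 (2 + u) ⦄ →
  ∃ λ k → m ≡ 2 ^ u * (1 + 2 * (ε + 2 * k))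
2^u∣m⇒m≡2^u*[1+2*[ε+2*k]] m u ε ε≤1 (divides q refl) m≡ = q / 4 , (begin
  q * 2 ^ u                         ≡⟨ *-comm q (2 ^ u) ⟩
  2 ^ u * q                         ≡⟨ cong (2 ^ u *_) (m≡m%n+[m/n]*n q 4) ⟩
  2 ^ u * (q % 4 + q / 4 * 4)       ≡⟨ cong (λ r → 2 ^ u * (r + q / 4 * 4)) q%4≡1+2ε ⟩
  2 ^ u * (1 + 2 * ε + q / 4 * 4)   ≡⟨ cong (2 ^ u *_) (regroup ε (q / 4)) ⟩
  2 ^ u * (1 + 2 * (ε + 2 * (q / 4))) ∎)
  where
  instance
    2^u≢0 : NonZero (2 ^ u)
    2^u≢0 = m^n≢0 2 u
    2^[2+u]≢0 : NonZero (2 ^ (2 + u))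
    2^[2+u]≢0 = m^n≢0 2 (2 + u)
    4*2^u≢0 : NonZero (4 * 2 ^ u)
    4*2^u≢0 = m*n≢0 4 (2 ^ u)
  regroup : ∀ e k → 1 + 2 * e + k * 4 ≡ 1 + 2 * (e + 2 * k)
  regroup = solve-∀
  factor : ∀ p e → p + e * (2 * p) ≡ (1 + 2 * e) * p
  factor = solve-∀
  2^[2+u]≡4*2^u : 2 ^ (2 + u) ≡ 4 * 2 ^ u
  2^[2+u]≡4*2^u = sym (*-assoc 2 2 (2 ^ u))
  q%4≡1+2ε : q % 4 ≡ 1 + 2 * ε
  q%4≡1+2ε = begin
    q % 4           ≡⟨ [m*o]%[n*o]≡[k*o]%[n*o]⇒m%n≡k%n q (1 + 2 * ε) 4 (2 ^ u) (begin
      (q * 2 ^ u) % (4 * 2 ^ u)                ≡⟨ %-congʳ 2^[2+u]≡4*2^u ⟨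
      (q * 2 ^ u) % 2 ^ (2 + u)                ≡⟨ m≡ ⟩
      (2 ^ u + ε * 2 ^ (1 + u)) % 2 ^ (2 + u)  ≡⟨ %-congˡ (factor (2 ^ u) ε) ⟩
      ((1 + 2 * ε) * 2 ^ u) % 2 ^ (2 + u)      ≡⟨ %-congʳ 2^[2+u]≡4*2^u ⟩
      ((1 + 2 * ε) * 2 ^ u) % (4 * 2 ^ u)      ∎) ⟩
    (1 + 2 * ε) % 4 ≡⟨ m<n⇒m%n≡m (s≤s (s≤s (*-monoʳ-≤ 2 ε≤1))) ⟩
    1 + 2 * ε       ∎

m+o≡n+p⇒[+m]-[+n]≡[+p]-[+o] : ∀ m n o p → m + o ≡ n + p → + m - + n ≡ + p - + o
m+o≡n+p⇒[+m]-[+n]≡[+p]-[+o] m n o p m+o≡n+p = begin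
  + m - + n         ≡⟨ [+m]-[+n]≡m⊖n m n ⟩
  m ⊖ n             ≡⟨ +-cancelˡ-⊖ o m n ⟨
  (o + m) ⊖ (o + n) ≡⟨ cong₂ _⊖_ (trans (+-comm o m) m+o≡n+p) (+-comm o n) ⟩
  (n + p) ⊖ (n + o) ≡⟨ +-cancelˡ-⊖ n p o ⟩
  p ⊖ o             ≡⟨ [+m]-[+n]≡m⊖n p o ⟨
  + p - + o         ∎

Classification : ℕ → ℕ → ℤ → Set
Classification u ε d =
  (d ≡ -[1+ 0 ] ⊎ d ≡ + 0 ⊎ d ≡ + 1)
  × (u ≡ 0 → ε ≡ 0 → d ≡ -[1+ 0 ])
  × (u ≡ 0 → ε ≡ 1 → d ≡ + 0)
  × (1 ≤ u → ε ≡ 0 → d ≡ + 0)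
  × (1 ≤ u → ε ≡ 1 → d ≡ + 1)

classify : ∀ u ε → ε ≤ 1 → Classification u ε (+ (1 ⊓ u + ε) - + 1)
classify zero    zero          _ = inj₁ refl , (λ _ _ → refl) , (λ _ ()) , (λ ()) , (λ ())
classify zero    (suc zero)    _ = inj₂ (inj₁ refl) , (λ _ ()) , (λ _ _ → refl) , (λ ()) , (λ ())
classify (suc u) zero          _ = inj₂ (inj₁ refl) , (λ ()) , (λ ()) , (λ _ _ → refl) , (λ _ ())
classify (suc u) (suc zero)    _ = inj₂ (inj₂ refl) , (λ ()) , (λ ()) , (λ _ ()) , (λ _ _ → refl)
classify _       (suc (suc _)) (s≤s ())

lemma2 : (n u ε : ℕ) →
    2 ^ u ∣ suc n → ¬ (2 ^ suc u ∣ suc n) →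
    ε ≤ 1 → _%_ (suc n) (2 ^ (2 + u)) ⦃ m^n≢0 2 (2 + u) ⦄ ≡ _%_ (2 ^ u + ε * 2 ^ (1 + u)) (2 ^ (2 + u)) ⦃ m^n≢0 2 (2 + u) ⦄ →
    ((+ r01 n - + r01 (suc n) ≡ -[1+ 0 ]) ⊎ (+ r01 n - + r01 (suc n) ≡ + 0) ⊎ (+ r01 n - + r01 (suc n) ≡ + 1))
    × (u ≡ 0 → ε ≡ 0 → + r01 n - + r01 (suc n) ≡ -[1+ 0 ])
    × (u ≡ 0 → ε ≡ 1 → + r01 n - + r01 (suc n) ≡ + 0)
    × (1 ≤ u → ε ≡ 0 → + r01 n - + r01 (suc n) ≡ + 0)
    × (1 ≤ u → ε ≡ 1 → + r01 n - + r01 (suc n) ≡ + 1)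
lemma2 n u ε 2^u∣n+1 _ ε≤1 n+1≡ with 2^u∣m⇒m≡2^u*[1+2*[ε+2*k]] (suc n) u ε ε≤1 2^u∣n+1 n+1≡
... | k , n+1≡2^u*odd = subst (Classification u ε) (sym Δ≡) (classify u ε ε≤1)
  where
  Δ≡ : + r01 n - + r01 (suc n) ≡ + (1 ⊓ u + ε) - + 1
  Δ≡ = m+o≡n+p⇒[+m]-[+n]≡[+p]-[+o] (r01 n) (r01 (suc n)) 1 (1 ⊓ u + ε)
         (r01[n]+1≡r01[1+n]+[1⊓u+ε] u ε k ε≤1 n+1≡2^u*odd)
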